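{- Let $r\geq4$, let $G$ be an extraspecial $2$-group of order $2^{2r+1}$ with centre $Z=\langle z\rangle$, suppose $\{Zg_1,\ldots,Zg_{2r}\}$ ($g_i\in G$) is a symmetric basis of $G/Z$ with respect to the quadratic form $Q(Zx)=x^2$, let $S=\{g_1,\ldots,g_{2r}\}$, $\Gamma=\mathrm{Cay}(G,S)$ and $A=\mathrm{Aut}(\Gamma)$. For distinct $i,j$ let $C_{ij}$ be the $8$-cycle of $\Gamma$ with vertices, in order, $\mathbf 1,\ g_i,\ g_jg_i,\ g_ig_jg_i,\ z,\ g_iz,\ g_jg_iz,\ g_j$. Let $\rho\in A$ fix the vertex $\mathbf 1$ and every vertex of $S$ (the neighbourhood of $\mathbf 1$). Then $\rho$ fixes every vertex of $C_{ij}$.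
   Context: An extraspecial $2$-group of order $2^{2r+1}$ is a $2$-group $G$ with $|Z(G)|=2$ and $G/Z(G)\cong\mathbb{Z}_2^{2r}$. Identifying $Z$ with $\mathbb{F}_2$, $Q(Zx)=x^2$ is a quadratic form on $G/Z$ with associated bilinear form $B(Zx,Zy)=[x,y]$. A basis is symmetric if $Q(v_i)=0$ for all $i$ and $B(v_i,v_j)=1$ for $i<j$; so the $g_i$ are involutions with $[g_i,g_j]=z$ for $i\neq j$. $\mathrm{Cay}(G,S)$ has vertex set $G$ and edges $\{x,sx\}$, $x\in G$, $s\in S$. -}

module Defs where

open import Level using (Level; _⊔_)
open import Algebra.Bundles using (Group)
open import Data.Nat using (ℕ; zero; suc; _*_; _+_; _^_)
open import Data.Fin using (Fin; zero; suc)
open import Data.Bool using (Bool; true; false; _xor_)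
open import Data.Product using (Σ; ∃; ∃-syntax; _×_; _,_)
open import Data.Sum using (_⊎_)
open import Relation.Nullary using (¬_)
open import Relation.Binary.PropositionalEquality as ≡ using (_≡_)
open import Function.Bundles using (Inverse)

module _ {c ℓ : Level} (G : Group c ℓ) where
  open Group G

  HasOrder : ℕ → Set (c ⊔ ℓ)
  HasOrder n = Inverse setoid (≡.setoid (Fin n))

  Central : Carrier → Set (c ⊔ ℓ)
  Central x = ∀ y → (x ∙ y) ≈ (y ∙ x)

  InZ : Carrier → Carrier → Set ℓ
  InZ z x = x ≈ ε ⊎ x ≈ z

  CentreIs : Carrier → Set (c ⊔ ℓ)
  CentreIs z = ¬ (z ≈ ε) × Central z × (∀ x → Central x → InZ z x)

  comm : Carrier → Carrier → Carrier
  comm x y = ((x ⁻¹ ∙ y ⁻¹) ∙ x) ∙ y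

  -- G / ⟨z⟩ ≅ ℤ₂^m : a surjective homomorphism G → 𝔽₂^m with kernel exactly ⟨z⟩
  QuotientElemAb : Carrier → ℕ → Set (c ⊔ ℓ)
  QuotientElemAb z m =
    Σ (Carrier → Fin m → Bool) λ φ →
      (∀ x y → x ≈ y → ∀ i → φ x i ≡ φ y i)
      × (∀ x y i → φ (x ∙ y) i ≡ (φ x i xor φ y i))
      × (∀ (v : Fin m → Bool) → ∃[ x ] (∀ i → φ x i ≡ v i))
      × (∀ x → ((∀ i → φ x i ≡ false) → InZ z x) × (InZ z x → ∀ i → φ x i ≡ false))

  IsExtraspecial : ℕ → Carrier → Set (c ⊔ ℓ)
  IsExtraspecial r z = HasOrder (2 ^ (2 * r + 1)) × CentreIs z × QuotientElemAb z (2 * r)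

  subprod : ∀ {m} → (Fin m → Bool) → (Fin m → Carrier) → Carrier
  subprod {zero} mask g = ε
  subprod {suc m} mask g with mask zero
  ... | true = g zero ∙ subprod (λ i → mask (suc i)) (λ i → g (suc i))
  ... | false = subprod (λ i → mask (suc i)) (λ i → g (suc i))

  -- {Z g_i} is a basis of the 𝔽₂-vector space G/Z (Z = ⟨z⟩):
  -- spanning: every coset Zx is a sum of some Zg_i;
  -- independent: a sum of Zg_i over a subset is 0 in G/Z only for the empty subset.
  IsBasisModZ : ∀ {m} → Carrier → (Fin m → Carrier) → Set (c ⊔ ℓ)
  IsBasisModZ z g =
    (∀ x → ∃[ mask ] ∃[ w ] (InZ z w × x ≈ (subprod mask g ∙ w)))
    × (∀ mask → InZ z (subprod mask g) → ∀ i → mask i ≡ false)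

  -- symmetric basis w.r.t. Q(Zx) = x² and B(Zx,Zy) = [x,y]:
  -- Q(Zg_i) = 0 (g_i² = 1) and B(Zg_i,Zg_j) = 1 (i.e. [g_i,g_j] = z) for i ≠ j
  IsSymmetricBasis : ∀ {m} → Carrier → (Fin m → Carrier) → Set (c ⊔ ℓ)
  IsSymmetricBasis z g =
    IsBasisModZ z g
    × (∀ i → (g i ∙ g i) ≈ ε)
    × (∀ i j → ¬ (i ≡ j) → comm (g i) (g j) ≈ z)

  CayAdj : ∀ {m} → (Fin m → Carrier) → Carrier → Carrier → Set ℓ
  CayAdj g x y = ∃[ i ] (y ≈ (g i ∙ x) ⊎ x ≈ (g i ∙ y))

  IsCayAut : ∀ {m} → (Fin m → Carrier) → Inverse setoid setoid → Set (c ⊔ ℓ)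
  IsCayAut g ρ = ∀ x y → (CayAdj g x y → CayAdj g (to x) (to y)) × (CayAdj g (to x) (to y) → CayAdj g x y)
    where open Inverse ρ

-- Because the cosets Z g_k are linearly independent, in any relation
-- g_{a₁} ⋯ g_{aₖ} x = g_{b₁} ⋯ g_{bₗ} x every index occurs an even number of times among the
-- a's and b's. The vertices g_a g_b and g_c g_d with a, b, c, d
-- distinct have no common neighbour. A vertex x with two fixed neighbours g_s x and g_t x is
-- fixed: its image is g_l g_s x = g_m g_t x, which forces l = s, or l = t and m = s, and the
-- latter would make g_s and g_t commute.
-- ρ sends g_a g_b to a neighbour g_τ g_b of g_b. If τ ∉ {a, b}, every g_c g_τ with c ∉ {a, b, τ}
-- goes to g_b g_τ: were its image g_c′ g_τ, then g_c′ g_τ g_b would be adjacent to the images of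
-- g_a g_b and of g_c g_τ. With n ≥ 5 there are two such c, contradicting injectivity. So every
-- g_a g_b is fixed, hence every g_a z (adjacent to g_a g_s and g_a g_t), hence z, and the
-- remaining vertices of C_ij are g_i g_j g_i = g_j z and g_j g_i z = g_i g_j.

module Submission where

open import Defs
open import Level using (Level)
open import Algebra.Bundles using (Group; CommutativeRing)
open import Data.Nat using (ℕ; zero; suc; _*_; _≤_; _<_; s≤s; z≤n)
open import Data.Fin using (Fin; zero; suc)
open import Data.Product using (_×_; ∃; _,_; proj₁; proj₂)
open import Relation.Nullary using (¬_; yes; no; does; ¬?)
open import Relation.Binary.PropositionalEquality as ≡ using (_≡_; _≢_; refl; module ≡-Reasoning)
open import Function.Bundles using (Inverse; Injection)

import Algebra.Properties.CommutativeSemigroup as CommutativeSemigroupProperties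
import Algebra.Properties.Group as GroupProperties
import Relation.Binary.Reasoning.Setoid
open import Data.Bool using (Bool; true; false; _∧_; _xor_)
open import Data.Bool.Properties
  using (xor-assoc; ∧-distribʳ-xor; ¬-not; xor-identityʳ; xor-same; xor-∧-commutativeRing)
open import Data.Empty using (⊥; ⊥-elim)
open import Data.Fin.Properties using (_≟_; any?; <⇒notInjective)
open import Data.List using (List; []; _∷_; length; lookup)
open import Data.List.Membership.Propositional using (_∈_; _∉_)
open import Data.List.Relation.Unary.All using ([]; _∷_) renaming (lookup to All-lookup)
open import Data.List.Relation.Unary.All.Properties using (All¬⇒¬Any)
open import Data.List.Relation.Unary.AllPairs using ([]; _∷_)
open import Data.List.Relation.Unary.Any using (here; there; index)
open import Data.List.Relation.Unary.Any.Properties using (lookup-index)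
open import Data.List.Relation.Unary.Unique.Propositional using (Unique)
import Data.Nat.Properties as ℕ
open import Data.Sum using (_⊎_; inj₁; inj₂; swap)
open import Function using (_∘_)
open import Function.Definitions using (Injective)
open import Function.Properties.Inverse using (Inverse⇒Injection)
open import Relation.Nullary.Decidable using (dec-true; dec-false; decidable-stable)

open GroupProperties (CommutativeRing.+-group xor-∧-commutativeRing)
  using () renaming (∙-cancelʳ to xor-cancelʳ; x∙y⁻¹≈ε⇒x≈y to xor≡false⇒≡)
open CommutativeSemigroupProperties (CommutativeRing.+-commutativeSemigroup xor-∧-commutativeRing)
  using () renaming (interchange to xor-interchange)

module _ {n : ℕ} where
  open import Data.List.Membership.DecPropositional (_≟_ {n}) using (_∈?_)

  parity : List (Fin n) → Fin n → Bool
  parity []       k = false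
  parity (a ∷ as) k = does (a ≟ k) xor parity as k

  parity-there : ∀ {a k} as → a ≢ k → parity (a ∷ as) k ≡ parity as k
  parity-there {a} {k} as a≢k rewrite dec-false (a ≟ k) a≢k = refl

  parity⇒∈ : ∀ as {k} → parity as k ≡ true → k ∈ as
  parity⇒∈ (a ∷ as) {k} odd with a ≟ k
  ... | yes refl = here refl
  ... | no  _    = there (parity⇒∈ as odd)

  parity-∉ : ∀ as {k} → k ∉ as → parity as k ≡ false
  parity-∉ as k∉as = ¬-not (k∉as ∘ parity⇒∈ as)

  parity-unique : ∀ {as k} → Unique as → k ∈ as → parity as k ≡ true
  parity-unique {a ∷ as} (a∉as ∷ _) (here refl)
    rewrite dec-true (a ≟ a) refl | parity-∉ as (All¬⇒¬Any a∉as) = refl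
  parity-unique {a ∷ as} (a∉as ∷ unique) (there k∈as) =
    ≡.trans (parity-there as (All-lookup a∉as k∈as)) (parity-unique unique k∈as)

  parity-heads : ∀ {p q as bs k} → parity (p ∷ as) k ≡ parity (q ∷ bs) k →
                 parity as k ≡ true → parity bs k ≡ false → p ≡ k ⊎ q ≡ k
  parity-heads {p} {q} {k = k} same odd even with p ≟ k | q ≟ k
  ... | yes p≡k | _       = inj₁ p≡k
  ... | no  _   | yes q≡k = inj₂ q≡k
  ... | no  _   | no  _   with () ← ≡.trans (≡.sym odd) (≡.trans same even)

  fresh : (xs : List (Fin n)) → length xs < n → ∃ λ k → k ∉ xs
  fresh xs |xs|<n with any? (λ k → ¬? (k ∈? xs))
  ... | yes k∉xs = k∉xs
  ... | no  ¬∃∉  = ⊥-elim (<⇒notInjective |xs|<n position-injective)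
    where
    member : ∀ k → k ∈ xs
    member k = decidable-stable (k ∈? xs) (¬∃∉ ∘ (k ,_))
    position-injective : Injective _≡_ _≡_ (index ∘ member)
    position-injective {i} {j} same =
      ≡.trans (lookup-index (member i))
              (≡.trans (≡.cong (lookup xs) same) (≡.sym (lookup-index (member j))))

combination : ∀ {m p} → (Fin m → Bool) → (Fin m → Fin p → Bool) → Fin p → Bool
combination {zero}  M U i = false
combination {suc m} M U i = (M zero ∧ U zero i) xor combination (M ∘ suc) (U ∘ suc) i

combination-xor : ∀ {m p} (M N : Fin m → Bool) (U : Fin m → Fin p → Bool) i →
  combination (λ k → M k xor N k) U i ≡ combination M U i xor combination N U i
combination-xor {zero}  M N U i = refl
combination-xor {suc m} M N U i =
  ≡.trans (≡.cong₂ _xor_ (∧-distribʳ-xor (U zero i) (M zero) (N zero))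
                         (combination-xor (M ∘ suc) (N ∘ suc) (U ∘ suc) i))
          (xor-interchange (M zero ∧ U zero i) (N zero ∧ U zero i) _ _)

combination-zero : ∀ {m p} (U : Fin m → Fin p → Bool) i → combination (λ _ → false) U i ≡ false
combination-zero {zero}  U i = refl
combination-zero {suc m} U i = combination-zero (U ∘ suc) i

combination-indicator : ∀ {m p} (a : Fin m) (U : Fin m → Fin p → Bool) i →
  combination (λ k → does (a ≟ k)) U i ≡ U a i
combination-indicator zero    U i rewrite combination-zero (U ∘ suc) i = xor-identityʳ (U zero i)
combination-indicator (suc a) U i = combination-indicator a (U ∘ suc) i

module _ {c ℓ} (G : Group c ℓ) where
  open Group G
  open GroupProperties G using (\\-leftDividesˡ; ∙-cancelˡ)
  open import Relation.Binary.Reasoning.Setoid setoid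

  ∙-comm-swap : ∀ x y → x ∙ y ≈ (y ∙ x) ∙ comm G x y
  ∙-comm-swap x y = sym (begin
    (y ∙ x) ∙ (((x ⁻¹ ∙ y ⁻¹) ∙ x) ∙ y) ≈⟨ assoc y x _ ⟩
    y ∙ (x ∙ (((x ⁻¹ ∙ y ⁻¹) ∙ x) ∙ y)) ≈⟨ ∙-congˡ (∙-congˡ (assoc _ x y)) ⟩
    y ∙ (x ∙ ((x ⁻¹ ∙ y ⁻¹) ∙ (x ∙ y))) ≈⟨ ∙-congˡ (∙-congˡ (assoc (x ⁻¹) (y ⁻¹) _)) ⟩
    y ∙ (x ∙ (x ⁻¹ ∙ (y ⁻¹ ∙ (x ∙ y)))) ≈⟨ ∙-congˡ (\\-leftDividesˡ x _) ⟩
    y ∙ (y ⁻¹ ∙ (x ∙ y))                 ≈⟨ \\-leftDividesˡ y (x ∙ y) ⟩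
    x ∙ y                                ∎)

  ∙-central : ∀ {x y} → Central G x → Central G y → Central G (x ∙ y)
  ∙-central {x} {y} x-central y-central w = begin
    (x ∙ y) ∙ w ≈⟨ assoc x y w ⟩
    x ∙ (y ∙ w) ≈⟨ ∙-congˡ (y-central w) ⟩
    x ∙ (w ∙ y) ≈⟨ assoc x w y ⟨
    (x ∙ w) ∙ y ≈⟨ ∙-congʳ (x-central w) ⟩
    (w ∙ x) ∙ y ≈⟨ assoc w x y ⟩
    w ∙ (x ∙ y) ∎

  CentreIs⇒z∙z≈ε : ∀ {z} → CentreIs G z → z ∙ z ≈ ε
  CentreIs⇒z∙z≈ε {z} (z≉ε , z-central , central⇒InZ)
    with central⇒InZ (z ∙ z) (∙-central z-central z-central)
  ... | inj₁ z∙z≈ε = z∙z≈ε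
  ... | inj₂ z∙z≈z = ⊥-elim (z≉ε (∙-cancelˡ z z ε (trans z∙z≈z (sym (identityʳ z)))))

no-three-distinct-in-pair : ∀ {A : Set} {a b c p q : A} → a ≢ b → a ≢ c → b ≢ c →
  p ≡ a ⊎ q ≡ a → p ≡ b ⊎ q ≡ b → p ≡ c ⊎ q ≡ c → ⊥
no-three-distinct-in-pair a≢b _   _   (inj₁ refl) (inj₁ refl) _           = a≢b refl
no-three-distinct-in-pair a≢b _   _   (inj₂ refl) (inj₂ refl) _           = a≢b refl
no-three-distinct-in-pair _   a≢c _   (inj₁ refl) (inj₂ refl) (inj₁ refl) = a≢c refl
no-three-distinct-in-pair _   _   b≢c (inj₁ refl) (inj₂ refl) (inj₂ refl) = b≢c refl
no-three-distinct-in-pair _   _   b≢c (inj₂ refl) (inj₁ refl) (inj₁ refl) = b≢c refl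
no-three-distinct-in-pair _   a≢c _   (inj₂ refl) (inj₁ refl) (inj₂ refl) = a≢c refl

module SymmetricBasis {c ℓ} (G : Group c ℓ)
  {n : ℕ} {z : Group.Carrier G} {g : Fin n → Group.Carrier G}
  (centre : CentreIs G z) (quotient : QuotientElemAb G z n) (basis : IsSymmetricBasis G z g) where

  open Group G renaming (refl to ≈-refl)
  open GroupProperties G using (∙-cancelˡ; ∙-cancelʳ)
  module ≈-Reasoning = Relation.Binary.Reasoning.Setoid setoid

  private
    z≉ε : ¬ z ≈ ε
    z≉ε = proj₁ centre

    z-central : Central G z
    z-central = proj₁ (proj₂ centre)

    z∙z≈ε : z ∙ z ≈ ε
    z∙z≈ε = CentreIs⇒z∙z≈ε G centre

    φ : Carrier → Fin n → Bool
    φ = proj₁ quotient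

    φ-cong : ∀ x y → x ≈ y → ∀ i → φ x i ≡ φ y i
    φ-cong = proj₁ (proj₂ quotient)

    φ-hom : ∀ x y i → φ (x ∙ y) i ≡ φ x i xor φ y i
    φ-hom = proj₁ (proj₂ (proj₂ quotient))

    φ-kernel : ∀ x → ((∀ i → φ x i ≡ false) → InZ G z x) × (InZ G z x → ∀ i → φ x i ≡ false)
    φ-kernel = proj₂ (proj₂ (proj₂ (proj₂ quotient)))

    independent : ∀ mask → InZ G z (subprod G mask g) → ∀ i → mask i ≡ false
    independent = proj₂ (proj₁ basis)

    g∙g≈ε : ∀ a → g a ∙ g a ≈ ε
    g∙g≈ε = proj₁ (proj₂ basis)

    commutator : ∀ a b → a ≢ b → comm G (g a) (g b) ≈ z
    commutator = proj₂ (proj₂ basis)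

  g-involutive : ∀ a x → g a ∙ (g a ∙ x) ≈ x
  g-involutive a x = begin
    g a ∙ (g a ∙ x) ≈⟨ assoc (g a) (g a) x ⟨
    (g a ∙ g a) ∙ x ≈⟨ ∙-congʳ (g∙g≈ε a) ⟩
    ε ∙ x           ≈⟨ identityˡ x ⟩
    x               ∎
    where open ≈-Reasoning

  g-swap : ∀ {a b} → a ≢ b → g a ∙ g b ≈ g b ∙ (g a ∙ z)
  g-swap {a} {b} a≢b = begin
    g a ∙ g b                        ≈⟨ ∙-comm-swap G (g a) (g b) ⟩
    (g b ∙ g a) ∙ comm G (g a) (g b) ≈⟨ ∙-congˡ (commutator a b a≢b) ⟩
    (g b ∙ g a) ∙ z                  ≈⟨ assoc (g b) (g a) z ⟩
    g b ∙ (g a ∙ z)                  ∎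
    where open ≈-Reasoning

  g-swap-act : ∀ {a b} → a ≢ b → ∀ x → g a ∙ (g b ∙ x) ≈ g b ∙ (g a ∙ (z ∙ x))
  g-swap-act {a} {b} a≢b x = begin
    g a ∙ (g b ∙ x)       ≈⟨ assoc (g a) (g b) x ⟨
    (g a ∙ g b) ∙ x       ≈⟨ ∙-congʳ (g-swap a≢b) ⟩
    (g b ∙ (g a ∙ z)) ∙ x ≈⟨ assoc (g b) _ x ⟩
    g b ∙ ((g a ∙ z) ∙ x) ≈⟨ ∙-congˡ (assoc (g a) z x) ⟩
    g b ∙ (g a ∙ (z ∙ x)) ∎
    where open ≈-Reasoning

  g-noncommuting : ∀ {a b} → a ≢ b → ∀ x → ¬ g a ∙ (g b ∙ x) ≈ g b ∙ (g a ∙ x)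
  g-noncommuting {a} {b} a≢b x commute = z≉ε (∙-cancelʳ x z ε (begin
    z ∙ x ≈⟨ ∙-cancelˡ (g a) _ _ (∙-cancelˡ (g b) _ _ (trans (sym (g-swap-act a≢b x)) commute)) ⟩
    x     ≈⟨ identityˡ x ⟨
    ε ∙ x ∎))
    where open ≈-Reasoning

  g-past-pair : ∀ {b c d} → b ≢ c → b ≢ d → g b ∙ (g c ∙ g d) ≈ g c ∙ (g d ∙ g b)
  g-past-pair {b} {c} {d} b≢c b≢d = begin
    g b ∙ (g c ∙ g d)             ≈⟨ g-swap-act b≢c (g d) ⟩
    g c ∙ (g b ∙ (z ∙ g d))       ≈⟨ ∙-congˡ (∙-congˡ (z-central (g d))) ⟩
    g c ∙ (g b ∙ (g d ∙ z))       ≈⟨ ∙-congˡ (g-swap-act b≢d z) ⟩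
    g c ∙ (g d ∙ (g b ∙ (z ∙ z))) ≈⟨ ∙-congˡ (∙-congˡ (∙-congˡ z∙z≈ε)) ⟩
    g c ∙ (g d ∙ (g b ∙ ε))       ≈⟨ ∙-congˡ (∙-congˡ (identityʳ (g b))) ⟩
    g c ∙ (g d ∙ g b)             ∎
    where open ≈-Reasoning

  g-conjugate : ∀ {a b} → a ≢ b → (g a ∙ g b) ∙ g a ≈ g b ∙ z
  g-conjugate {a} {b} a≢b = begin
    (g a ∙ g b) ∙ g a       ≈⟨ assoc (g a) (g b) (g a) ⟩
    g a ∙ (g b ∙ g a)       ≈⟨ ∙-congˡ (g-swap (a≢b ∘ ≡.sym)) ⟩
    g a ∙ (g a ∙ (g b ∙ z)) ≈⟨ g-involutive a (g b ∙ z) ⟩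
    g b ∙ z                 ∎
    where open ≈-Reasoning

  act : List (Fin n) → Carrier → Carrier
  act []       x = x
  act (a ∷ as) x = g a ∙ act as x

  φ-subprod : ∀ {m} (M : Fin m → Bool) (h : Fin m → Carrier) i →
              φ (subprod G M h) i ≡ combination M (φ ∘ h) i
  φ-subprod {zero}  M h i = proj₂ (φ-kernel ε) (inj₁ ≈-refl) i
  φ-subprod {suc m} M h i with M zero
  ... | true  = ≡.trans (φ-hom _ _ i)
                        (≡.cong (φ (h zero) i xor_) (φ-subprod (M ∘ suc) (h ∘ suc) i))
  ... | false = φ-subprod (M ∘ suc) (h ∘ suc) i

  φ-act : ∀ as x i → φ (act as x) i ≡ combination (parity as) (φ ∘ g) i xor φ x i
  φ-act []       x i = ≡.cong (_xor φ x i) (≡.sym (combination-zero (φ ∘ g) i))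
  φ-act (a ∷ as) x i = begin
    φ (g a ∙ act as x) i                     ≡⟨ φ-hom (g a) (act as x) i ⟩
    φ (g a) i xor φ (act as x) i             ≡⟨ ≡.cong (φ (g a) i xor_) (φ-act as x i) ⟩
    φ (g a) i xor (C as xor φ x i)           ≡⟨ xor-assoc (φ (g a) i) (C as) (φ x i) ⟨
    (φ (g a) i xor C as) xor φ x i           ≡⟨ ≡.cong (_xor φ x i) C-∷ ⟨
    C (a ∷ as) xor φ x i                     ∎
    where
    open ≡-Reasoning
    C : List (Fin n) → Bool
    C bs = combination (parity bs) (φ ∘ g) i
    C-∷ : C (a ∷ as) ≡ φ (g a) i xor C as
    C-∷ = ≡.trans (combination-xor _ (parity as) (φ ∘ g) i)
                  (≡.cong (_xor C as) (combination-indicator a (φ ∘ g) i))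

  act-parity : ∀ {as bs x} → act as x ≈ act bs x → ∀ k → parity as k ≡ parity bs k
  act-parity {as} {bs} {x} same k = xor≡false⇒≡ _ _ (independent M (proj₁ (φ-kernel _) φ-M) k)
    where
    open ≡-Reasoning
    M : Fin n → Bool
    M l = parity as l xor parity bs l
    C : List (Fin n) → Fin n → Bool
    C cs i = combination (parity cs) (φ ∘ g) i
    C-same : ∀ i → C as i ≡ C bs i
    C-same i = xor-cancelʳ (φ x i) _ _
      (≡.trans (≡.sym (φ-act as x i)) (≡.trans (φ-cong _ _ same i) (φ-act bs x i)))
    φ-M : ∀ i → φ (subprod G M g) i ≡ false
    φ-M i = begin
      φ (subprod G M g) i     ≡⟨ φ-subprod M g i ⟩
      combination M (φ ∘ g) i ≡⟨ combination-xor (parity as) (parity bs) (φ ∘ g) i ⟩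
      C as i xor C bs i       ≡⟨ ≡.cong (_xor C bs i) (C-same i) ⟩
      C bs i xor C bs i       ≡⟨ xor-same (C bs i) ⟩
      false                   ∎

  act-heads : ∀ {p q as bs x k} → act (p ∷ as) x ≈ act (q ∷ bs) x →
              Unique as → k ∈ as → k ∉ bs → p ≡ k ⊎ q ≡ k
  act-heads {p} {q} {as} {bs} same unique k∈as k∉bs =
    parity-heads {p = p} {q = q} {as = as} {bs = bs}
      (act-parity {p ∷ as} {q ∷ bs} same _) (parity-unique unique k∈as) (parity-∉ bs k∉bs)

  g-injective : ∀ {a b} → g a ≈ g b → a ≡ b
  g-injective {a} {b} ga≈gb
    with parity⇒∈ (b ∷ []) (≡.trans (≡.sym (act-parity {a ∷ []} {b ∷ []} {ε} (∙-congʳ ga≈gb) a))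
                                     (parity-unique {as = a ∷ []} ([] ∷ []) (here refl)))
  ... | here a≡b = a≡b

  g∙g≈ε⇒≡ : ∀ {a b} → g a ∙ g b ≈ ε → a ≡ b
  g∙g≈ε⇒≡ {a} {b} ga∙gb≈ε =
    g-injective (∙-cancelʳ (g b) _ _ (trans ga∙gb≈ε (sym (g∙g≈ε b))))

  disjoint-pairs-no-common-neighbour : ∀ {a b c d p q} → Unique (a ∷ b ∷ c ∷ d ∷ []) →
    ¬ g p ∙ (g a ∙ g b) ≈ g q ∙ (g c ∙ g d)
  disjoint-pairs-no-common-neighbour {a} {b} {c} {d} {p} {q}
    ((a≢b ∷ a≢c ∷ a≢d ∷ []) ∷ (b≢c ∷ b≢d ∷ []) ∷ (c≢d ∷ []) ∷ [] ∷ []) same =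
    no-three-distinct-in-pair a≢b a≢c b≢c
      (act-heads same′ ab-unique (here refl) (All¬⇒¬Any (a≢c ∷ a≢d ∷ [])))
      (act-heads same′ ab-unique (there (here refl)) (All¬⇒¬Any (b≢c ∷ b≢d ∷ [])))
      (swap (act-heads (sym same′) cd-unique (here refl)
                       (All¬⇒¬Any ((a≢c ∘ ≡.sym) ∷ (b≢c ∘ ≡.sym) ∷ []))))
    where
    ab-unique : Unique (a ∷ b ∷ [])
    ab-unique = (a≢b ∷ []) ∷ [] ∷ []
    cd-unique : Unique (c ∷ d ∷ [])
    cd-unique = (c≢d ∷ []) ∷ [] ∷ []
    same′ : act (p ∷ a ∷ b ∷ []) ε ≈ act (q ∷ c ∷ d ∷ []) ε
    same′ = trans (∙-congˡ (∙-congˡ (identityʳ (g b))))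
                  (trans same (∙-congˡ (∙-congˡ (sym (identityʳ (g d))))))

  adjacent⇒step : ∀ {x y} → CayAdj G g x y → ∃ λ k → y ≈ g k ∙ x
  adjacent⇒step (k , inj₁ y≈gk∙x) = k , y≈gk∙x
  adjacent⇒step {x} {y} (k , inj₂ x≈gk∙y) =
    k , trans (sym (g-involutive k y)) (∙-congˡ (sym x≈gk∙y))

  module Automorphism (ρ : Inverse setoid setoid) (automorphism : IsCayAut G g ρ)
                      (ρ-ε : Inverse.to ρ ε ≈ ε) (ρ-g : ∀ k → Inverse.to ρ (g k) ≈ g k) where

    open Inverse ρ using (to; from; to-cong; strictlyInverseˡ)

    Fixed : Carrier → Set ℓ
    Fixed x = to x ≈ x

    fixed-resp : ∀ {x y} → x ≈ y → Fixed y → Fixed x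
    fixed-resp x≈y y-fixed = trans (to-cong x≈y) (trans y-fixed (sym x≈y))

    to-injective : ∀ {x y} → to x ≈ to y → x ≈ y
    to-injective = Injection.injective (Inverse⇒Injection ρ)

    neighbour-of-fixed : ∀ {k x y} → y ≈ g k ∙ x → Fixed x → ∃ λ l → to y ≈ g l ∙ x
    neighbour-of-fixed {k} {x} {y} y≈gk∙x x-fixed
      with l , moved ← adjacent⇒step (proj₁ (automorphism x y) (k , inj₁ y≈gk∙x))
      = l , trans moved (∙-congˡ x-fixed)

    preimage-of-neighbour : ∀ {k x w} → w ≈ g k ∙ to x → ∃ λ l → from w ≈ g l ∙ x
    preimage-of-neighbour {k} {x} {w} w≈gk∙to-x =
      adjacent⇒step (proj₂ (automorphism x (from w))
                           (k , inj₁ (trans (strictlyInverseˡ w) w≈gk∙to-x)))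

    fixed-by-two-fixed-neighbours : ∀ {s t x} → s ≢ t → Fixed (g s ∙ x) → Fixed (g t ∙ x) → Fixed x
    fixed-by-two-fixed-neighbours {s} {t} {x} s≢t gs∙x-fixed gt∙x-fixed
      with l₁ , moved₁ ← neighbour-of-fixed (sym (g-involutive s x)) gs∙x-fixed
         | l₂ , moved₂ ← neighbour-of-fixed (sym (g-involutive t x)) gt∙x-fixed
      with act-heads (trans (sym moved₁) moved₂) ([] ∷ []) (here refl) (All¬⇒¬Any (s≢t ∷ []))
         | act-heads (trans (sym moved₂) moved₁) ([] ∷ []) (here refl) (All¬⇒¬Any ((s≢t ∘ ≡.sym) ∷ []))
    ... | inj₁ refl | _         = trans moved₁ (g-involutive s x)
    ... | inj₂ refl | inj₁ refl = ⊥-elim (s≢t refl)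
    ... | inj₂ refl | inj₂ refl = ⊥-elim (g-noncommuting (s≢t ∘ ≡.sym) x (trans (sym moved₁) moved₂))

    pair-not-to-ε : ∀ {a b c} → a ≢ b → ¬ to (g a ∙ g b) ≈ g c ∙ g c
    pair-not-to-ε {a} {b} {c} a≢b moved =
      a≢b (g∙g≈ε⇒≡ (to-injective (trans moved (trans (g∙g≈ε c) (sym ρ-ε)))))

    pair-shift : ∀ {a b c τ} → Unique (a ∷ b ∷ c ∷ τ ∷ []) →
      to (g a ∙ g b) ≈ g τ ∙ g b → to (g c ∙ g τ) ≈ g b ∙ g τ
    pair-shift {a} {b} {c} {τ} distinct@(_ ∷ (_ ∷ b≢τ ∷ []) ∷ (c≢τ ∷ []) ∷ _) moved
      with c′ , moved′ ← neighbour-of-fixed ≈-refl (ρ-g τ)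
      with c′ ≟ b | c′ ≟ τ
    ... | yes refl | _        = moved′
    ... | no  _    | yes refl = ⊥-elim (pair-not-to-ε c≢τ moved′)
    ... | no  c′≢b | no  c′≢τ
      -- g c′ ∙ (g τ ∙ g b) is adjacent to both images, so its preimage is a common neighbour
      with p , w≈gp∙ab ← preimage-of-neighbour (∙-congˡ (sym moved))
         | q , w≈gq∙cτ ← preimage-of-neighbour
                             (trans (sym (g-past-pair (c′≢b ∘ ≡.sym) b≢τ)) (∙-congˡ (sym moved′)))
      = ⊥-elim (disjoint-pairs-no-common-neighbour distinct (trans (sym w≈gp∙ab) w≈gq∙cτ))

    module _ (5≤n : 5 ≤ n) where

      pair-fixed : ∀ {a b} → a ≢ b → Fixed (g a ∙ g b)
      pair-fixed {a} {b} a≢b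
        with τ , moved ← neighbour-of-fixed ≈-refl (ρ-g b)
        with τ ≟ a | τ ≟ b
      ... | yes refl | _        = moved
      ... | no  _    | yes refl = ⊥-elim (pair-not-to-ε a≢b moved)
      ... | no  τ≢a  | no  τ≢b
        with c₁ , c₁∉ ← fresh (a ∷ b ∷ τ ∷ []) (ℕ.<⇒≤ 5≤n)
        with c₂ , c₂∉ ← fresh (c₁ ∷ a ∷ b ∷ τ ∷ []) 5≤n
        = ⊥-elim (c₂∉ (here (g-injective (∙-cancelʳ (g τ) _ _ (to-injective
            (trans (pair-shift (distinct (c₂∉ ∘ there)) moved)
                   (sym (pair-shift (distinct c₁∉) moved))))))))
        where
        distinct : ∀ {c} → c ∉ a ∷ b ∷ τ ∷ [] → Unique (a ∷ b ∷ c ∷ τ ∷ [])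
        distinct c∉ = (a≢b ∷ (c∉ ∘ here ∘ ≡.sym) ∷ (τ≢a ∘ ≡.sym) ∷ [])
                    ∷ ((c∉ ∘ there ∘ here ∘ ≡.sym) ∷ (τ≢b ∘ ≡.sym) ∷ [])
                    ∷ ((c∉ ∘ there ∘ there ∘ here) ∷ [])
                    ∷ [] ∷ []

      g∙z-fixed : ∀ a → Fixed (g a ∙ z)
      g∙z-fixed a
        with s , s∉ ← fresh (a ∷ []) (ℕ.≤-trans (s≤s (s≤s z≤n)) 5≤n)
        with t , t∉ ← fresh (s ∷ a ∷ []) (ℕ.≤-trans (s≤s (s≤s (s≤s z≤n))) 5≤n)
        = fixed-by-two-fixed-neighbours (t∉ ∘ here ∘ ≡.sym)
            (neighbour-fixed s∉) (neighbour-fixed (t∉ ∘ there))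
        where
        neighbour-fixed : ∀ {s} → s ∉ a ∷ [] → Fixed (g s ∙ (g a ∙ z))
        neighbour-fixed {s} s∉ = fixed-resp (sym (g-swap a≢s)) (pair-fixed a≢s)
          where
          a≢s : a ≢ s
          a≢s = s∉ ∘ here ∘ ≡.sym

5≤2*r : ∀ {r} → 4 ≤ r → 5 ≤ 2 * r
5≤2*r 4≤r = ℕ.≤-trans (ℕ.m≤m+n 5 3) (ℕ.*-monoʳ-≤ 2 4≤r)

lemma4p4 : {c ℓ : Level} (G : Group c ℓ) (r : ℕ) → 4 ≤ r →
    (z : Group.Carrier G) → IsExtraspecial G r z →
    (g : Fin (2 * r) → Group.Carrier G) → IsSymmetricBasis G z g →
    (ρ : Inverse (Group.setoid G) (Group.setoid G)) → IsCayAut G g ρ →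
    Group._≈_ G (Inverse.to ρ (Group.ε G)) (Group.ε G) →
    (∀ k → Group._≈_ G (Inverse.to ρ (g k)) (g k)) →
    (i j : Fin (2 * r)) → ¬ (i ≡ j) →
    let open Group G
        fixed = λ v → Inverse.to ρ v ≈ v
    in fixed ε × fixed (g i) × fixed (g j ∙ g i) × fixed ((g i ∙ g j) ∙ g i)
       × fixed z × fixed (g i ∙ z) × fixed ((g j ∙ g i) ∙ z) × fixed (g j)
lemma4p4 G r 4≤r z (_ , centre , quotient) g basis ρ automorphism ρ-ε ρ-g i j i≢j =
  ρ-ε , ρ-g i , pair-fixed 5≤n (i≢j ∘ ≡.sym) , fixed-resp (g-conjugate i≢j) (g∙z-fixed 5≤n j) ,
  fixed-by-two-fixed-neighbours i≢j (g∙z-fixed 5≤n i) (g∙z-fixed 5≤n j) , g∙z-fixed 5≤n i ,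
  fixed-resp (trans (assoc (g j) (g i) z) (sym (g-swap i≢j))) (pair-fixed 5≤n i≢j) , ρ-g j
  where
  open Group G
  open SymmetricBasis G centre quotient basis
  open Automorphism ρ automorphism ρ-ε ρ-g
  5≤n : 5 ≤ 2 * r
  5≤n = 5≤2*r 4≤r
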